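{- There exists $a\ge 2$ such that for every $\varepsilon\in(0,\tfrac12]$ and every $\varepsilon^a$-sparse $P_5$-free graph $G$ with $|G|\ge\varepsilon^{ -a}$, there is an anticomplete blockade $(B_1,\ldots,B_k)$ in $G$ with $k\ge\varepsilon^{ -1}$ and $|B_i|\ge\varepsilon^a|G|$ for all $i\in\{1,\dots,k\}$.
   Context: All graphs are finite, simple; $P_5$-free means no induced subgraph isomorphic to the five-vertex path; $|G|$ is the number of vertices. For $\varepsilon>0$, $G$ is $\varepsilon$-sparse if its maximum degree is at most $\varepsilon|G|$. A blockade is a sequence of pairwise disjoint vertex subsets; it is anticomplete if there are no edges between any two distinct members.
   Formalization: The parameter ε ranges over the rationals in (0,½]. -}

module Defs where

open import Data.Nat as ℕ using (ℕ; zero; suc)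
open import Data.Integer using (+_)
open import Data.Rational using (ℚ; _/_; _*_; 1ℚ)
open import Data.Bool using (Bool; true; false)
open import Data.Fin using (Fin; toℕ)
open import Data.Fin.Subset using (Subset; _∈_; ∣_∣)
open import Data.Vec using (tabulate)
open import Data.Sum using (_⊎_)
open import Data.Product using (Σ; _×_)
open import Function.Definitions using (Injective)
open import Function.Bundles using (_⇔_)
open import Relation.Binary.PropositionalEquality using (_≡_; _≢_)
open import Relation.Nullary using (¬_)

ℕ→ℚ : ℕ → ℚ
ℕ→ℚ n = + n / 1

_^ℚ_ : ℚ → ℕ → ℚ
q ^ℚ zero = 1ℚ
q ^ℚ suc k = q * (q ^ℚ k)

record Graph (n : ℕ) : Set where
  field
    adj     : Fin n → Fin n → Bool
    sym     : ∀ u v → adj u v ≡ adj v u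
    irrefl  : ∀ v → adj v v ≡ false
open Graph public

∣_∣ᴳ : ∀ {n} → Graph n → ℕ
∣_∣ᴳ {n} _ = n

Adj : ∀ {n} → Graph n → Fin n → Fin n → Set
Adj G u v = adj G u v ≡ true

N : ∀ {n} → Graph n → Fin n → Subset n
N G v = tabulate (adj G v)

degree : ∀ {n} → Graph n → Fin n → ℕ
degree G v = ∣ N G v ∣

Sparse : ℚ → ∀ {n} → Graph n → Set
Sparse ε {n} G = ∀ v → ℕ→ℚ (degree G v) Data.Rational.≤ ε * ℕ→ℚ n

P5adj : Fin 5 → Fin 5 → Set
P5adj i j = (toℕ i ≡ suc (toℕ j)) ⊎ (toℕ j ≡ suc (toℕ i))

InducedP5 : ∀ {n} → Graph n → (Fin 5 → Fin n) → Set
InducedP5 G f = Injective _≡_ _≡_ f × (∀ i j → Adj G (f i) (f j) ⇔ P5adj i j)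

P5Free : ∀ {n} → Graph n → Set
P5Free G = ∀ f → ¬ InducedP5 G f

IsBlockade : ∀ {n k} → (Fin k → Subset n) → Set
IsBlockade {n} B = ∀ i j → i ≢ j → ∀ (v : Fin n) → v ∈ B i → ¬ (v ∈ B j)

IsAnticompleteBlockade : ∀ {n k} → Graph n → (Fin k → Subset n) → Set
IsAnticompleteBlockade G B =
  IsBlockade B × (∀ i j → i ≢ j → ∀ u v → u ∈ B i → v ∈ B j → ¬ Adj G u v)

{-# OPTIONS --safe #-}
module Submission where

-- Take k with 1 ≤ kε ≤ 2, let c = 2k + 1 and m = ⌊n / c⁵⌋.  Since cε ≤ 5 and
-- 2·5⁵·2⁻¹³ ≤ 1, we get ε¹⁸ n ≤ m, so every degree is at most m.
-- If m ≤ t and |S| ≥ k(m + t), cutting S along the components of G[S] yields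
-- k pairwise anticomplete pieces of at least m vertices each, unless G[S] has
-- a component with more than t vertices.  Apply this to V(G) with t = c⁴m to
-- find a large connected C and a vertex v of it, then to C ∖ N[v] with t
-- smaller by a factor c.  A large component C′ found there is joined to the
-- rest of C by an edge whose end u outside C′ lies in N(v); continue from u
-- in C′.  As |N[v]| ≤ m + 1, the factor c keeps the size requirement intact,
-- and after four steps the chosen vertices form an induced P₅.

open import Defs hiding (sym)
open import Data.Bool using (true)
import Data.Bool.Properties as Bool
open import Data.Empty using (⊥-elim)
open import Data.Fin using (Fin; zero; suc; toℕ)
open import Data.Fin.Properties using (all?; any?)
open import Data.Fin.Subset
open import Data.Fin.Subset.Properties
open import Data.Nat as ℕ using (ℕ; zero; suc; _≥_)
import Data.Nat.Properties as ℕ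
open import Data.Product using (Σ; ∃; ∃₂; _×_; _,_)
open import Data.Sum using (_⊎_; inj₁; inj₂; swap; map)
open import Data.Vec using (Vec; []; _∷_; there; lookup)
open import Data.Vec.Properties using (lookup∘tabulate; []=⇒lookup; lookup⇒[]=)
open import Data.Vec.Relation.Unary.All using (All; []; _∷_)
import Data.Vec.Relation.Unary.All as All
open import Data.Vec.Relation.Unary.All.Properties using (lookup⁺)
import Data.Vec.Functional as Vector
open import Function using (_∘_)
open import Function.Bundles using (_⇔_; mk⇔)
open import Function.Properties.Equivalence using () renaming (trans to ⇔-trans)
open import Relation.Binary.PropositionalEquality
  using (_≡_; _≢_; refl; sym; trans; cong; cong₂; subst; subst₂)
open import Relation.Nullary using (Dec; yes; no; ¬_; ¬?; contradiction)
open import Relation.Nullary.Decidable using (_×-dec_; _→-dec_; toWitness; toWitnessFalse)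

module _ where

  open import Data.Nat using (_+_; _*_; _^_; _≤_; _<_; z≤n; s≤s)
  open import Data.Nat.Properties
  open import Data.Nat.Induction using (<-wellFounded)
  open import Data.Nat.Tactic.RingSolver using (solve-∀)
  open import Induction.WellFounded using (Acc; acc)

  private variable
    n : ℕ

  x∈p─q⇒x∉q : ∀ {x} (p q : Subset n) → x ∈ p ─ q → x ∉ q
  x∈p─q⇒x∉q (_ ∷ p) (inside ∷ q) (there x∈) (there x∈q) = x∈p─q⇒x∉q p q x∈ x∈q
  x∈p─q⇒x∉q (_ ∷ p) (outside ∷ q) (there x∈) (there x∈q) = x∈p─q⇒x∉q p q x∈ x∈q

  x∈p∧x∉p─q⇒x∈q : ∀ {x} {p q : Subset n} → x ∈ p → x ∉ p ─ q → x ∈ q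
  x∈p∧x∉p─q⇒x∈q {x = x} {q = q} x∈p x∉p─q with x ∈? q
  ... | yes x∈q = x∈q
  ... | no x∉q = contradiction (x∈p∧x∉q⇒x∈p─q x∈p x∉q) x∉p─q

  ∣p∣≤∣q∣+∣p─q∣ : ∀ (p q : Subset n) → ∣ p ∣ ≤ ∣ q ∣ + ∣ p ─ q ∣
  ∣p∣≤∣q∣+∣p─q∣ [] [] = z≤n
  ∣p∣≤∣q∣+∣p─q∣ (outside ∷ p) (outside ∷ q) = ∣p∣≤∣q∣+∣p─q∣ p q
  ∣p∣≤∣q∣+∣p─q∣ (outside ∷ p) (inside ∷ q) = ≤-trans (∣p∣≤∣q∣+∣p─q∣ p q) (n≤1+n _)
  ∣p∣≤∣q∣+∣p─q∣ (inside ∷ p) (outside ∷ q) =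
    ≤-trans (s≤s (∣p∣≤∣q∣+∣p─q∣ p q)) (≤-reflexive (sym (+-suc _ _)))
  ∣p∣≤∣q∣+∣p─q∣ (inside ∷ p) (inside ∷ q) = s≤s (∣p∣≤∣q∣+∣p─q∣ p q)

  ∣p∪q∣≤∣p∣+∣q∣ : ∀ (p q : Subset n) → ∣ p ∪ q ∣ ≤ ∣ p ∣ + ∣ q ∣
  ∣p∪q∣≤∣p∣+∣q∣ p q = ≤-trans (∣p∣≤∣q∣+∣p─q∣ (p ∪ q) q)
    (≤-trans (+-monoʳ-≤ ∣ q ∣ (p⊆q⇒∣p∣≤∣q∣ [p∪q]─q⊆p)) (≤-reflexive (+-comm ∣ q ∣ ∣ p ∣)))
    where
    [p∪q]─q⊆p : (p ∪ q) ─ q ⊆ p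
    [p∪q]─q⊆p x∈ with x∈p∪q⁻ p q (p─q⊆p (p ∪ q) q x∈)
    ... | inj₁ x∈p = x∈p
    ... | inj₂ x∈q = contradiction x∈q (x∈p─q⇒x∉q (p ∪ q) q x∈)

  0<∣p∣⇒nonempty : ∀ {p : Subset n} → 0 < ∣ p ∣ → Nonempty p
  0<∣p∣⇒nonempty {n} {p} 0<∣p∣ with nonempty? p
  ... | yes p≠∅ = p≠∅
  ... | no p=∅ with Empty-unique p=∅
  ... | refl = contradiction (sym (∣⊥∣≡0 n)) (<⇒≢ 0<∣p∣)

  larger-summand : ∀ {m a b} → m + m ≤ a + b → m ≤ a ⊎ m ≤ b
  larger-summand {m} {a} {b} m+m≤a+b with m ≤? a | m ≤? b
  ... | yes m≤a | _ = inj₁ m≤a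
  ... | no _ | yes m≤b = inj₂ m≤b
  ... | no m≰a | no m≰b = contradiction m+m≤a+b (<⇒≱ (+-mono-< (≰⇒> m≰a) (≰⇒> m≰b)))

  threshold : ℕ → ℕ → ℕ → ℕ
  threshold k m ℓ = suc (2 * k) ^ ℓ * m

  m≤threshold : ∀ k m ℓ → m ≤ threshold k m ℓ
  m≤threshold k m ℓ = m≤n*m m (suc (2 * k) ^ ℓ) {{m^n≢0 (suc (2 * k)) ℓ}}

  threshold-suc : ∀ k m ℓ → m + k * (m + threshold k m ℓ) ≤ threshold k m (suc ℓ)
  threshold-suc k m ℓ = begin
    m + k * (m + t)                   ≤⟨ +-mono-≤ m≤t (*-monoʳ-≤ k (+-monoˡ-≤ t m≤t)) ⟩
    t + k * (t + t)                   ≡⟨ regroup k t ⟩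
    suc (2 * k) * t                   ≡⟨ *-assoc (suc (2 * k)) (suc (2 * k) ^ ℓ) m ⟨
    threshold k m (suc ℓ)             ∎
    where
    open ≤-Reasoning
    t = threshold k m ℓ
    m≤t = m≤threshold k m ℓ
    regroup : ∀ k t → t + k * (t + t) ≡ suc (2 * k) * t
    regroup = solve-∀

  -- The path on Fin ℓ; P5adj is the case ℓ = 5.
  Consecutive : ∀ {ℓ} → Fin ℓ → Fin ℓ → Set
  Consecutive i j = toℕ i ≡ suc (toℕ j) ⊎ toℕ j ≡ suc (toℕ i)

  module _ {n : ℕ} (G : Graph n) where

    Adj? : ∀ u v → Dec (Adj G u v)
    Adj? u v = adj G u v Bool.≟ true

    Adj-sym : ∀ {u v} → Adj G u v → Adj G v u
    Adj-sym {u} {v} u~v = trans (Graph.sym G v u) u~v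

    Adj⇒≢ : ∀ {u v} → Adj G u v → u ≢ v
    Adj⇒≢ {u} u~u refl with trans (sym u~u) (irrefl G u)
    ... | ()

    ∈N⇒Adj : ∀ {v x} → x ∈ N G v → Adj G v x
    ∈N⇒Adj {v} {x} x∈N = trans (sym (lookup∘tabulate (adj G v) x)) ([]=⇒lookup x∈N)

    Adj⇒∈N : ∀ {v x} → Adj G v x → x ∈ N G v
    Adj⇒∈N {v} {x} v~x = lookup⇒[]= x (N G v) (trans (lookup∘tabulate (adj G v) x) v~x)

    N[_] : Fin n → Subset n
    N[ v ] = ⁅ v ⁆ ∪ N G v

    v∈N[v] : ∀ v → v ∈ N[ v ]
    v∈N[v] v = x∈p∪q⁺ (inj₁ (x∈⁅x⁆ v))

    Adj⇒∈N[] : ∀ {v x} → Adj G v x → x ∈ N[ v ]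
    Adj⇒∈N[] v~x = x∈p∪q⁺ (inj₂ (Adj⇒∈N v~x))

    ∉N[]⇒¬Adj : ∀ {v x} → x ∉ N[ v ] → ¬ Adj G v x
    ∉N[]⇒¬Adj x∉N[v] v~x = x∉N[v] (Adj⇒∈N[] v~x)

    ∉N[]⇒≢ : ∀ {v x} → x ∉ N[ v ] → v ≢ x
    ∉N[]⇒≢ {v} v∉N[v] refl = v∉N[v] (v∈N[v] v)

    ∣N[]∣≤1+degree : ∀ v → ∣ N[ v ] ∣ ≤ suc (degree G v)
    ∣N[]∣≤1+degree v =
      ≤-trans (∣p∪q∣≤∣p∣+∣q∣ ⁅ v ⁆ (N G v)) (≤-reflexive (cong (_+ degree G v) (∣⁅x⁆∣≡1 v)))

    -- For X ⊆ S: X is a union of components of G[S].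
    Isolated : Subset n → Subset n → Set
    Isolated S X = ∀ u v → u ∈ X → v ∈ S → v ∉ X → ¬ Adj G u v

    isolated? : ∀ S X → Dec (Isolated S X)
    isolated? S X = all? λ u → all? λ v →
      (u ∈? X) →-dec ((v ∈? S) →-dec (¬? (v ∈? X) →-dec ¬? (Adj? u v)))

    isolated-refl : ∀ S → Isolated S S
    isolated-refl S u v u∈S v∈S v∉S = contradiction v∈S v∉S

    isolated-trans : ∀ {S X Y} → Y ⊆ X → Isolated X Y → Isolated S X → Isolated S Y
    isolated-trans {X = X} Y⊆X Y-iso X-iso u v u∈Y v∈S v∉Y with v ∈? X
    ... | yes v∈X = Y-iso u v u∈Y v∈X v∉Y
    ... | no v∉X = X-iso u v (Y⊆X u∈Y) v∈S v∉X

    isolated-complement : ∀ {X Y} → Isolated X Y → Isolated X (X ─ Y)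
    isolated-complement {X} {Y} Y-iso u v u∈X─Y v∈X v∉X─Y u~v =
      Y-iso v u (x∈p∧x∉p─q⇒x∈q v∈X v∉X─Y) (p─q⊆p X Y u∈X─Y) (x∈p─q⇒x∉q X Y u∈X─Y) (Adj-sym u~v)

    Disconnected : Subset n → Set
    Disconnected X = ∃ λ Y → Y ⊆ X × Nonempty Y × Nonempty (X ─ Y) × Isolated X Y

    Connected : Subset n → Set
    Connected X = ¬ Disconnected X

    disconnected? : ∀ X → Dec (Disconnected X)
    disconnected? X = anySubset? λ Y →
      (Y ⊆? X) ×-dec nonempty? Y ×-dec nonempty? (X ─ Y) ×-dec isolated? X Y

    connected⇒edge-leaves : ∀ {X Y} → Connected X → Y ⊆ X → Nonempty Y → Nonempty (X ─ Y) →
      ∃₂ λ a b → a ∈ Y × b ∈ X × b ∉ Y × Adj G a b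
    connected⇒edge-leaves {X} {Y} X-conn Y⊆X Y≠∅ X─Y≠∅
      with any? (λ a → any? λ b → (a ∈? Y) ×-dec (b ∈? X) ×-dec ¬? (b ∈? Y) ×-dec Adj? a b)
    ... | yes edge = edge
    ... | no no-edge = ⊥-elim (X-conn (Y , Y⊆X , Y≠∅ , X─Y≠∅ ,
            λ a b a∈Y b∈X b∉Y a~b → no-edge (a , b , a∈Y , b∈X , b∉Y , a~b)))

    record Blockade (S : Subset n) (k m : ℕ) : Set where
      constructor blockade
      field
        block        : Fin k → Subset n
        anticomplete : IsAnticompleteBlockade G block
        block⊆S      : ∀ i → block i ⊆ S
        large        : ∀ i → m ≤ ∣ block i ∣

    empty-blockade : ∀ {S m} → Blockade S 0 m
    empty-blockade = blockade (λ ()) ((λ ()) , (λ ())) (λ ()) (λ ())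

    weaken : ∀ {S S′ k m} → S ⊆ S′ → Blockade S k m → Blockade S′ k m
    weaken S⊆S′ (blockade B B-anti B⊆S B-large) = blockade B B-anti (λ i → ⊆-trans (B⊆S i) S⊆S′) B-large

    extend : ∀ {S T k m} → T ⊆ S → Isolated S T → m ≤ ∣ T ∣ → Blockade (S ─ T) k m → Blockade S (suc k) m
    extend {S} {T} {k} {m} T⊆S T-iso m≤∣T∣ (blockade B (disjoint , apart) B⊆S─T B-large) =
      blockade (T Vector.∷ B) (disjoint′ , apart′) block⊆S′ large′
      where
      ∈S : ∀ i {x} → x ∈ B i → x ∈ S
      ∈S i x∈Bi = p─q⊆p S T (B⊆S─T i x∈Bi)
      ∉T : ∀ i {x} → x ∈ B i → x ∉ T
      ∉T i x∈Bi = x∈p─q⇒x∉q S T (B⊆S─T i x∈Bi)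
      disjoint′ : IsBlockade (T Vector.∷ B)
      disjoint′ zero zero i≢j = ⊥-elim (i≢j refl)
      disjoint′ zero (suc j) _ v v∈T v∈Bj = ∉T j v∈Bj v∈T
      disjoint′ (suc i) zero _ v v∈Bi v∈T = ∉T i v∈Bi v∈T
      disjoint′ (suc i) (suc j) i≢j = disjoint i j (i≢j ∘ cong suc)
      apart′ : ∀ i j → i ≢ j → ∀ u v → u ∈ (T Vector.∷ B) i → v ∈ (T Vector.∷ B) j → ¬ Adj G u v
      apart′ zero zero i≢j = ⊥-elim (i≢j refl)
      apart′ zero (suc j) _ u v u∈T v∈Bj = T-iso u v u∈T (∈S j v∈Bj) (∉T j v∈Bj)
      apart′ (suc i) zero _ u v u∈Bi v∈T u~v = T-iso v u v∈T (∈S i u∈Bi) (∉T i u∈Bi) (Adj-sym u~v)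
      apart′ (suc i) (suc j) i≢j = apart i j (i≢j ∘ cong suc)
      block⊆S′ : ∀ i → (T Vector.∷ B) i ⊆ S
      block⊆S′ zero = T⊆S
      block⊆S′ (suc i) = ∈S i
      large′ : ∀ i → m ≤ ∣ (T Vector.∷ B) i ∣
      large′ zero = m≤∣T∣
      large′ (suc i) = B-large i

    record LargeComponent (S : Subset n) (t : ℕ) : Set where
      constructor component
      field
        vertices   : Subset n
        vertices⊆S : vertices ⊆ S
        isolated   : Isolated S vertices
        connected  : Connected vertices
        large      : t < ∣ vertices ∣

    lift-component : ∀ {S T t} → Isolated S T → LargeComponent (S ─ T) t → LargeComponent S t
    lift-component {S} {T} T-iso (component C C⊆S─T C-iso C-conn C-large) =
      component C (⊆-trans C⊆S─T (p─q⊆p S T))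
        (isolated-trans C⊆S─T C-iso (isolated-complement T-iso)) C-conn C-large

    record Piece (S : Subset n) (m t : ℕ) : Set where
      constructor piece
      field
        part     : Subset n
        part⊆S   : part ⊆ S
        isolated : Isolated S part
        lower    : m ≤ ∣ part ∣
        upper    : ∣ part ∣ ≤ m + t

    piece-or-component : ∀ {S m t} → m ≤ t → ∀ X → X ⊆ S → Isolated S X → m ≤ ∣ X ∣ →
      Acc _<_ ∣ X ∣ → Piece S m t ⊎ LargeComponent S t
    piece-or-component {S} {m} {t} m≤t X X⊆S X-iso m≤∣X∣ (acc smaller)
      with ∣ X ∣ ≤? m + t | disconnected? X
    ... | yes small | _ = inj₁ (piece X X⊆S X-iso m≤∣X∣ small)
    ... | no big | no X-conn = inj₂ (component X X⊆S X-iso X-conn (≤-trans (s≤s (m≤n+m t m)) (≰⇒> big)))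
    ... | no big | yes (Y , Y⊆X , (y , y∈Y) , (z , z∈X─Y) , Y-iso)
      -- |X| > m + t ≥ 2m, so one side of the split keeps m vertices.
      with larger-summand (≤-trans (+-monoʳ-≤ m m≤t) (<⇒≤ (<-≤-trans (≰⇒> big) (∣p∣≤∣q∣+∣p─q∣ X Y))))
    ... | inj₁ m≤∣Y∣ = piece-or-component m≤t Y (⊆-trans Y⊆X X⊆S) (isolated-trans Y⊆X Y-iso X-iso) m≤∣Y∣
            (smaller (p⊂q⇒∣p∣<∣q∣ (Y⊆X , z , p─q⊆p X Y z∈X─Y , x∈p─q⇒x∉q X Y z∈X─Y)))
    ... | inj₂ m≤∣X─Y∣ = piece-or-component m≤t (X ─ Y) (⊆-trans (p─q⊆p X Y) X⊆S)
            (isolated-trans (p─q⊆p X Y) (isolated-complement Y-iso) X-iso) m≤∣X─Y∣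
            (smaller (p∩q≢∅⇒∣p─q∣<∣p∣ X Y (y , x∈p∩q⁺ (Y⊆X y∈Y , y∈Y))))

    blockade-or-component : ∀ {m t} → m ≤ t → ∀ k S → k * (m + t) ≤ ∣ S ∣ →
      Blockade S k m ⊎ LargeComponent S t
    blockade-or-component m≤t zero S _ = inj₁ empty-blockade
    blockade-or-component {m} {t} m≤t (suc k) S size
      with piece-or-component m≤t S ⊆-refl (isolated-refl S)
             (≤-trans (m≤m+n m t) (≤-trans (m≤m+n (m + t) _) size)) (<-wellFounded ∣ S ∣)
    ... | inj₂ C = inj₂ C
    ... | inj₁ (piece T T⊆S T-iso m≤∣T∣ ∣T∣≤m+t)
      with blockade-or-component m≤t k (S ─ T)
             (+-cancelˡ-≤ (m + t) _ _ (≤-trans size (≤-trans (∣p∣≤∣q∣+∣p─q∣ S T) (+-monoˡ-≤ _ ∣T∣≤m+t))))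
    ... | inj₁ B = inj₁ (extend T⊆S T-iso m≤∣T∣ B)
    ... | inj₂ C = inj₂ (lift-component T-iso C)

    record Extension (C : Subset n) (v : Fin n) (t : ℕ) : Set where
      constructor extension
      field
        next        : Fin n
        next∈C      : next ∈ C
        v~next      : Adj G v next
        rest        : LargeComponent (C ─ N[ v ]) t
        anchor      : Fin n
        anchor∈rest : anchor ∈ LargeComponent.vertices rest
        next~anchor : Adj G next anchor

    component⇒extension : ∀ {C v w t} → Connected C → w ∈ C → w ∈ N[ v ] →
      LargeComponent (C ─ N[ v ]) t → Extension C v t
    component⇒extension {C} {v} {w} C-conn w∈C w∈N[v] K@(component C′ C′⊆C─N[v] C′-iso _ C′-large)
      with connected⇒edge-leaves C-conn (⊆-trans C′⊆C─N[v] (p─q⊆p C N[ v ]))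
             (0<∣p∣⇒nonempty (≤-trans (s≤s z≤n) C′-large))
             (w , x∈p∧x∉q⇒x∈p─q w∈C λ w∈C′ → x∈p─q⇒x∉q C N[ v ] (C′⊆C─N[v] w∈C′) w∈N[v])
    ... | a , b , a∈C′ , b∈C , b∉C′ , a~b
      with x∈p∪q⁻ ⁅ v ⁆ (N G v) (x∈p∧x∉p─q⇒x∈q b∈C λ b∈C─N[v] → C′-iso a b a∈C′ b∈C─N[v] b∉C′ a~b)
    ... | inj₁ b∈⁅v⁆ = ⊥-elim (x∈p─q⇒x∉q C N[ v ] (C′⊆C─N[v] a∈C′)
                         (Adj⇒∈N[] (Adj-sym (subst (Adj G a) (x∈⁅y⁆⇒x≡y v b∈⁅v⁆) a~b))))
    ... | inj₂ b∈N[v] = extension b b∈C (∈N⇒Adj b∈N[v]) K a a∈C′ (Adj-sym a~b)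

    blockade-or-extension : ∀ {k m t C v w} → m ≤ t → (∀ v → degree G v ≤ m) →
      Connected C → w ∈ C → w ∈ N[ v ] → m + k * (m + t) < ∣ C ∣ →
      Blockade (C ─ N[ v ]) k m ⊎ Extension C v t
    blockade-or-extension {k} {m} {t} {C} {v} m≤t degree≤m C-conn w∈C w∈N[v] C-large
      with blockade-or-component m≤t k (C ─ N[ v ]) (+-cancelˡ-≤ (suc m) _ _
             (≤-trans C-large (≤-trans (∣p∣≤∣q∣+∣p─q∣ C N[ v ])
               (+-monoˡ-≤ _ (≤-trans (∣N[]∣≤1+degree v) (s≤s (degree≤m v)))))))
    ... | inj₁ B = inj₁ B
    ... | inj₂ K = inj₂ (component⇒extension C-conn w∈C w∈N[v] K)

    data IsInducedPath : ∀ {ℓ} → Vec (Fin n) (suc ℓ) → Set where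
      [_]  : ∀ v → IsInducedPath (v ∷ [])
      link : ∀ {ℓ u v} {vs : Vec (Fin n) ℓ} → Adj G u v → All (_∉ N[ u ]) vs →
             IsInducedPath (v ∷ vs) → IsInducedPath (u ∷ v ∷ vs)

    head-apart : ∀ {ℓ v} {vs : Vec (Fin n) ℓ} → IsInducedPath (v ∷ vs) → ∀ i → v ≢ lookup vs i
    head-apart (link v~w _ _) zero = Adj⇒≢ v~w
    head-apart (link _ far _) (suc i) = ∉N[]⇒≢ (lookup⁺ far i)

    head-adjacent : ∀ {ℓ v} {vs : Vec (Fin n) ℓ} → IsInducedPath (v ∷ vs) →
      ∀ i → Adj G v (lookup vs i) ⇔ Consecutive {suc ℓ} zero (suc i)
    head-adjacent (link v~w _ _) zero = mk⇔ (λ _ → inj₂ refl) (λ _ → v~w)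
    head-adjacent (link _ far _) (suc i) =
      mk⇔ (⊥-elim ∘ ∉N[]⇒¬Adj (lookup⁺ far i)) λ { (inj₁ ()) ; (inj₂ ()) }

    path-injective : ∀ {ℓ} {vs : Vec (Fin n) (suc ℓ)} → IsInducedPath vs →
      ∀ {i j} → lookup vs i ≡ lookup vs j → i ≡ j
    path-injective _ {zero} {zero} _ = refl
    path-injective {vs = _ ∷ _} p {zero} {suc j} v≡x = ⊥-elim (head-apart p j v≡x)
    path-injective {vs = _ ∷ _} p {suc i} {zero} x≡v = ⊥-elim (head-apart p i (sym x≡v))
    path-injective (link _ _ p) {suc i} {suc j} x≡y = cong suc (path-injective p x≡y)

    path-adjacent : ∀ {ℓ} {vs : Vec (Fin n) (suc ℓ)} → IsInducedPath vs →
      ∀ i j → Adj G (lookup vs i) (lookup vs j) ⇔ Consecutive i j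
    path-adjacent _ zero zero = mk⇔ (λ v~v → ⊥-elim (Adj⇒≢ v~v refl)) λ { (inj₁ ()) ; (inj₂ ()) }
    path-adjacent {vs = _ ∷ _} p zero (suc j) = head-adjacent p j
    path-adjacent {vs = _ ∷ _} p (suc i) zero =
      ⇔-trans (mk⇔ Adj-sym Adj-sym) (⇔-trans (head-adjacent p i) (mk⇔ swap swap))
    path-adjacent (link _ _ p) (suc i) (suc j) =
      ⇔-trans (path-adjacent p i j) (mk⇔ (map (cong suc) (cong suc)) (map suc-injective suc-injective))

    blockade-or-path : ∀ {k m} ℓ {C v w} → (∀ v → degree G v ≤ m) →
      Connected C → w ∈ C → w ∈ N[ v ] → threshold k m ℓ < ∣ C ∣ →
      Blockade ⊤ k m ⊎ ∃ λ (vs : Vec (Fin n) ℓ) → IsInducedPath (v ∷ vs) × All (_∈ C) vs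
    blockade-or-path zero {v = v} _ _ _ _ _ = inj₂ ([] , [ v ] , [])
    blockade-or-path {k} {m} (suc ℓ) {C} {v} degree≤m C-conn w∈C w∈N[v] C-large
      with blockade-or-extension (m≤threshold k m ℓ) degree≤m C-conn w∈C w∈N[v]
             (≤-trans (s≤s (threshold-suc k m ℓ)) C-large)
    ... | inj₁ B = inj₁ (weaken ⊆⊤ B)
    ... | inj₂ (extension u u∈C v~u (component C′ C′⊆C─N[v] _ C′-conn C′-large) a a∈C′ u~a)
      with blockade-or-path ℓ degree≤m C′-conn a∈C′ (Adj⇒∈N[] u~a) C′-large
    ... | inj₁ B = inj₁ B
    ... | inj₂ (vs , path , vs⊆C′) =
      inj₂ (u ∷ vs , link v~u (All.map (x∈p─q⇒x∉q C N[ v ] ∘ C′⊆C─N[v]) vs⊆C′) path ,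
            u∈C ∷ All.map (p─q⊆p C N[ v ] ∘ C′⊆C─N[v]) vs⊆C′)

    blockade-or-induced-path : ∀ {k m} ℓ → (∀ v → degree G v ≤ m) → threshold k m (suc ℓ) ≤ n →
      Blockade ⊤ k m ⊎ ∃ λ (vs : Vec (Fin n) (suc ℓ)) → IsInducedPath vs
    blockade-or-induced-path {k} {m} ℓ degree≤m n-large
      with blockade-or-component (m≤threshold k m ℓ) k ⊤
             (≤-trans (m≤n+m _ m) (≤-trans (threshold-suc k m ℓ)
               (≤-trans n-large (≤-reflexive (sym (∣⊤∣≡n n))))))
    ... | inj₁ B = inj₁ B
    ... | inj₂ (component C _ _ C-conn C-large) with 0<∣p∣⇒nonempty (≤-trans (s≤s z≤n) C-large)
    ... | v , v∈C with blockade-or-path ℓ degree≤m C-conn v∈C (v∈N[v] v) C-large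
    ... | inj₁ B = inj₁ B
    ... | inj₂ (vs , path , _) = inj₂ (v ∷ vs , path)

    P5-free⇒blockade : ∀ {k m} → P5Free G → (∀ v → degree G v ≤ m) → threshold k m 5 ≤ n → Blockade ⊤ k m
    P5-free⇒blockade P5-free degree≤m n-large with blockade-or-induced-path 4 degree≤m n-large
    ... | inj₁ B = B
    ... | inj₂ (vs , path) = ⊥-elim (P5-free (lookup vs) (path-injective path , path-adjacent path))

open import Data.Integer using (+_; +<+)
import Data.Integer as ℤ
import Data.Integer.Properties as ℤ
open import Data.Nat.Coprimality using (Coprime; 1-coprimeTo) renaming (sym to coprime-sym)
open import Data.Nat.DivMod using (_/_; m≡m%n+[m/n]*n; m%n<n; m/n*n≤m)
open import Data.Nat.Tactic.RingSolver using (solve-∀)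
open import Data.Rational as ℚ
  using (ℚ; mkℚ; _+_; _*_; _≤_; _<_; 0ℚ; 1ℚ; ½; NonNegative; Positive; nonNegative; *≤*; *<*)
open import Data.Rational.Properties
open import Data.Rational.Solver using (module +-*-Solver)
import Data.Rational.Unnormalised as ℚᵘ
import Data.Rational.Unnormalised.Properties as ℚᵘ
open +-*-Solver using (solve; _:+_; _:*_; _:^_; _:=_; con)

ℕ→ℚ≡mkℚ : ∀ n → ℕ→ℚ n ≡ mkℚ (+ n) 0 (coprime-sym (1-coprimeTo n))
ℕ→ℚ≡mkℚ n = normalize-coprime (coprime-sym (1-coprimeTo n))

ℕ→ℚ-nonNeg : ∀ n → NonNegative (ℕ→ℚ n)
ℕ→ℚ-nonNeg n = normalize-nonNeg n 1

ℕ→ℚ-+ : ∀ a b → ℕ→ℚ (a ℕ.+ b) ≡ ℕ→ℚ a + ℕ→ℚ b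
ℕ→ℚ-+ a b rewrite ℕ→ℚ≡mkℚ a | ℕ→ℚ≡mkℚ b = cong (λ i → i ℚ./ 1)
  (trans (ℤ.pos-+ a b) (sym (cong₂ ℤ._+_ (ℤ.*-identityʳ (+ a)) (ℤ.*-identityʳ (+ b)))))

ℕ→ℚ-* : ∀ a b → ℕ→ℚ (a ℕ.* b) ≡ ℕ→ℚ a * ℕ→ℚ b
ℕ→ℚ-* a b rewrite ℕ→ℚ≡mkℚ a | ℕ→ℚ≡mkℚ b = cong (λ i → i ℚ./ 1) (ℤ.pos-* a b)

ℕ→ℚ-^ : ∀ c j → ℕ→ℚ (c ℕ.^ j) ≡ ℕ→ℚ c ^ℚ j
ℕ→ℚ-^ c zero = refl
ℕ→ℚ-^ c (suc j) = trans (ℕ→ℚ-* c (c ℕ.^ j)) (cong (ℕ→ℚ c *_) (ℕ→ℚ-^ c j))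

ℕ→ℚ-mono-≤ : ∀ {a b} → a ℕ.≤ b → ℕ→ℚ a ≤ ℕ→ℚ b
ℕ→ℚ-mono-≤ {a} {b} a≤b rewrite ℕ→ℚ≡mkℚ a | ℕ→ℚ≡mkℚ b =
  *≤* (subst₂ ℤ._≤_ (sym (ℤ.*-identityʳ (+ a))) (sym (ℤ.*-identityʳ (+ b))) (ℤ.+≤+ a≤b))

ℕ→ℚ-cancel-≤ : ∀ {a b} → ℕ→ℚ a ≤ ℕ→ℚ b → a ℕ.≤ b
ℕ→ℚ-cancel-≤ {a} {b} a≤b rewrite ℕ→ℚ≡mkℚ a | ℕ→ℚ≡mkℚ b with a≤b
... | *≤* a≤b = ℤ.drop‿+≤+ (subst₂ ℤ._≤_ (ℤ.*-identityʳ (+ a)) (ℤ.*-identityʳ (+ b)) a≤b)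

mkℚ*denominator : ∀ p q .(c : Coprime p (suc q)) → mkℚ (+ p) q c * ℕ→ℚ (suc q) ≡ ℕ→ℚ p
mkℚ*denominator p q c rewrite ℕ→ℚ≡mkℚ (suc q) | ℕ→ℚ≡mkℚ p =
  toℚᵘ-injective (ℚᵘ.≃-trans
    (toℚᵘ-homo-* (mkℚ (+ p) q c) (mkℚ (+ suc q) 0 (coprime-sym (1-coprimeTo (suc q)))))
    (ℚᵘ.*≡* (trans (ℤ.*-identityʳ _) (cong ((+ p) ℤ.*_) (cong +_ (sym (ℕ.*-identityʳ (suc q))))))))

*-mono-≤-nonNeg : ∀ {a b c d} → 0ℚ ≤ a → a ≤ b → 0ℚ ≤ c → c ≤ d → a * c ≤ b * d
*-mono-≤-nonNeg {a} {b} {c} {d} 0≤a a≤b 0≤c c≤d =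
  ≤-trans (*-monoʳ-≤-nonNeg c {{nonNegative 0≤c}} a≤b)
          (*-monoˡ-≤-nonNeg b {{nonNegative (≤-trans 0≤a a≤b)}} c≤d)

^ℚ-nonNeg : ∀ j {x} → 0ℚ ≤ x → 0ℚ ≤ x ^ℚ j
^ℚ-nonNeg zero _ = toWitness {a? = 0ℚ ≤? 1ℚ} _
^ℚ-nonNeg (suc j) {x} 0≤x =
  nonNegative⁻¹ _ {{nonNeg*nonNeg⇒nonNeg x {{nonNegative 0≤x}} _ {{nonNegative (^ℚ-nonNeg j 0≤x)}}}}

^ℚ-mono-≤ : ∀ j {x y} → 0ℚ ≤ x → x ≤ y → x ^ℚ j ≤ y ^ℚ j
^ℚ-mono-≤ zero _ _ = ≤-refl
^ℚ-mono-≤ (suc j) 0≤x x≤y = *-mono-≤-nonNeg 0≤x x≤y (^ℚ-nonNeg j 0≤x) (^ℚ-mono-≤ j 0≤x x≤y)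

n<[1+n/d]*d : ∀ n d .{{_ : ℕ.NonZero d}} → n ℕ.< suc (n / d) ℕ.* d
n<[1+n/d]*d n d =
  subst (ℕ._< suc (n / d) ℕ.* d) (sym (m≡m%n+[m/n]*n n d)) (ℕ.+-monoˡ-< ((n / d) ℕ.* d) (m%n<n n d))

multiple-in-[1,2] : ∀ ε → 0ℚ < ε → ε ≤ 1ℚ → ∃ λ k → 1ℚ ≤ ℕ→ℚ k * ε × ℕ→ℚ k * ε ≤ ℕ→ℚ 2
multiple-in-[1,2] (mkℚ (+ zero) q c) (*<* (+<+ ()))
multiple-in-[1,2] ε@(mkℚ (+ suc p) q c) _ ε≤1 = k , 1≤kε , kε≤2
  where
  P = suc p
  Q = suc q
  k = suc (Q / P)
  instance
    Q-pos : Positive (ℕ→ℚ Q)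
    Q-pos = normalize-pos Q 1
  εQ≡P : ε * ℕ→ℚ Q ≡ ℕ→ℚ P
  εQ≡P = mkℚ*denominator P q c
  P≤Q : P ℕ.≤ Q
  P≤Q = ℕ→ℚ-cancel-≤
    (subst₂ _≤_ εQ≡P (*-identityˡ (ℕ→ℚ Q)) (*-monoʳ-≤-nonNeg (ℕ→ℚ Q) {{ℕ→ℚ-nonNeg Q}} ε≤1))
  kP≤2Q : k ℕ.* P ℕ.≤ 2 ℕ.* Q
  kP≤2Q = ℕ.+-mono-≤ P≤Q (ℕ.≤-trans (m/n*n≤m Q P) (ℕ.m≤m+n Q 0))
  kεQ≡kP : ℕ→ℚ k * ε * ℕ→ℚ Q ≡ ℕ→ℚ (k ℕ.* P)
  kεQ≡kP = trans (*-assoc (ℕ→ℚ k) ε (ℕ→ℚ Q)) (trans (cong (ℕ→ℚ k *_) εQ≡P) (sym (ℕ→ℚ-* k P)))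
  1≤kε : 1ℚ ≤ ℕ→ℚ k * ε
  1≤kε = *-cancelʳ-≤-pos (ℕ→ℚ Q)
    (subst₂ _≤_ (sym (*-identityˡ (ℕ→ℚ Q))) (sym kεQ≡kP) (ℕ→ℚ-mono-≤ (ℕ.<⇒≤ (n<[1+n/d]*d Q P))))
  kε≤2 : ℕ→ℚ k * ε ≤ ℕ→ℚ 2
  kε≤2 = *-cancelʳ-≤-pos (ℕ→ℚ Q) (subst₂ _≤_ (sym kεQ≡kP) (ℕ→ℚ-* 2 Q) (ℕ→ℚ-mono-≤ kP≤2Q))

[1+2k]ε≤5 : ∀ k {ε} → ε ≤ ½ → ℕ→ℚ k * ε ≤ ℕ→ℚ 2 → ℕ→ℚ (suc (2 ℕ.* k)) * ε ≤ ℕ→ℚ 5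
[1+2k]ε≤5 k {ε} ε≤½ kε≤2 = begin
  ℕ→ℚ (1 ℕ.+ 2 ℕ.* k) * ε   ≡⟨ cong (_* ε) (trans (ℕ→ℚ-+ 1 (2 ℕ.* k)) (cong (_+_ 1ℚ) (ℕ→ℚ-* 2 k))) ⟩
  (1ℚ + ℕ→ℚ 2 * ℕ→ℚ k) * ε  ≡⟨ solve 2 (λ K ε → (con 1ℚ :+ con (ℕ→ℚ 2) :* K) :* ε
                                             := ε :+ con (ℕ→ℚ 2) :* (K :* ε)) refl (ℕ→ℚ k) ε ⟩
  ε + ℕ→ℚ 2 * (ℕ→ℚ k * ε)   ≤⟨ +-mono-≤ ε≤½ (*-monoˡ-≤-nonNeg (ℕ→ℚ 2) {{ℕ→ℚ-nonNeg 2}} kε≤2) ⟩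
  ½ + ℕ→ℚ 2 * ℕ→ℚ 2         ≤⟨ toWitness {a? = ½ + ℕ→ℚ 2 * ℕ→ℚ 2 ≤? ℕ→ℚ 5} _ ⟩
  ℕ→ℚ 5                     ∎
  where open ≤-Reasoning

-- The solver reads :^ as the ring's power, which unfolds to _^ℚ_.
ε¹⁸·2c⁵≤1 : ∀ c {ε} → 0ℚ ≤ ε → ε ≤ ½ → ℕ→ℚ c * ε ≤ ℕ→ℚ 5 → ε ^ℚ 18 * ℕ→ℚ (2 ℕ.* c ℕ.^ 5) ≤ 1ℚ
ε¹⁸·2c⁵≤1 c {ε} 0≤ε ε≤½ cε≤5 = begin
  ε ^ℚ 18 * ℕ→ℚ (2 ℕ.* c ℕ.^ 5)          ≡⟨ cong (ε ^ℚ 18 *_)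
                                               (trans (ℕ→ℚ-* 2 (c ℕ.^ 5)) (cong (ℕ→ℚ 2 *_) (ℕ→ℚ-^ c 5))) ⟩
  ε ^ℚ 18 * (ℕ→ℚ 2 * ℕ→ℚ c ^ℚ 5)         ≡⟨ solve 2 (λ ε C → ε :^ 18 :* (con (ℕ→ℚ 2) :* C :^ 5)
                                                      := con (ℕ→ℚ 2) :* ((C :* ε) :^ 5 :* ε :^ 13))
                                                 refl ε (ℕ→ℚ c) ⟩
  ℕ→ℚ 2 * ((ℕ→ℚ c * ε) ^ℚ 5 * ε ^ℚ 13)  ≤⟨ *-monoˡ-≤-nonNeg (ℕ→ℚ 2) {{ℕ→ℚ-nonNeg 2}}
                                              (*-mono-≤-nonNeg (^ℚ-nonNeg 5 0≤cε) (^ℚ-mono-≤ 5 0≤cε cε≤5)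
                                                               (^ℚ-nonNeg 13 0≤ε) (^ℚ-mono-≤ 13 0≤ε ε≤½)) ⟩
  ℕ→ℚ 2 * (ℕ→ℚ 5 ^ℚ 5 * ½ ^ℚ 13)         ≤⟨ toWitness {a? = ℕ→ℚ 2 * (ℕ→ℚ 5 ^ℚ 5 * ½ ^ℚ 13) ≤? 1ℚ} _ ⟩
  1ℚ                                      ∎
  where
  open ≤-Reasoning
  0≤cε : 0ℚ ≤ ℕ→ℚ c * ε
  0≤cε = nonNegative⁻¹ _ {{nonNeg*nonNeg⇒nonNeg (ℕ→ℚ c) {{ℕ→ℚ-nonNeg c}} ε {{nonNegative 0≤ε}}}}

δ*a≤b : ∀ {δ} L {a} b → 0ℚ ≤ δ → δ * ℕ→ℚ (2 ℕ.* L) ≤ 1ℚ → a ℕ.≤ b ℕ.* (2 ℕ.* L) → δ * ℕ→ℚ a ≤ ℕ→ℚ b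
δ*a≤b {δ} L {a} b 0≤δ δ2L≤1 a≤2Lb = begin
  δ * ℕ→ℚ a                    ≤⟨ *-monoˡ-≤-nonNeg δ {{nonNegative 0≤δ}} (ℕ→ℚ-mono-≤ a≤2Lb) ⟩
  δ * ℕ→ℚ (b ℕ.* (2 ℕ.* L))    ≡⟨ cong (δ *_) (ℕ→ℚ-* b (2 ℕ.* L)) ⟩
  δ * (ℕ→ℚ b * ℕ→ℚ (2 ℕ.* L))  ≡⟨ solve 3 (λ d b x → d :* (b :* x) := b :* (d :* x))
                                           refl δ (ℕ→ℚ b) (ℕ→ℚ (2 ℕ.* L)) ⟩
  ℕ→ℚ b * (δ * ℕ→ℚ (2 ℕ.* L))  ≤⟨ *-monoˡ-≤-nonNeg (ℕ→ℚ b) {{ℕ→ℚ-nonNeg b}} δ2L≤1 ⟩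
  ℕ→ℚ b * 1ℚ                   ≡⟨ *-identityʳ (ℕ→ℚ b) ⟩
  ℕ→ℚ b                        ∎
  where open ≤-Reasoning

δn≤n/L : ∀ {δ} n L .{{_ : ℕ.NonZero L}} → 0ℚ ≤ δ → δ * ℕ→ℚ (2 ℕ.* L) ≤ 1ℚ → 1ℚ ≤ ℕ→ℚ n * δ →
  δ * ℕ→ℚ n ≤ ℕ→ℚ (n / L)
δn≤n/L {δ} n L 0≤δ δ2L≤1 1≤nδ with n / L | n<[1+n/d]*d n L
... | zero | n<L = contradiction 2≤1 (toWitnessFalse {a? = ℕ→ℚ 2 ≤? 1ℚ} _)
  where
  open ≤-Reasoning
  n≤L : n ℕ.≤ L
  n≤L = ℕ.<⇒≤ (ℕ.≤-trans n<L (ℕ.≤-reflexive (ℕ.*-identityˡ L)))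
  L+L≡1*[2*L] : ∀ L → L ℕ.+ L ≡ 1 ℕ.* (2 ℕ.* L)
  L+L≡1*[2*L] = solve-∀
  1≤δn : 1ℚ ≤ δ * ℕ→ℚ n
  1≤δn = ≤-trans 1≤nδ (≤-reflexive (*-comm (ℕ→ℚ n) δ))
  2≤1 : ℕ→ℚ 2 ≤ 1ℚ
  2≤1 = begin
    ℕ→ℚ 2                  ≤⟨ toWitness {a? = ℕ→ℚ 2 ≤? 1ℚ + 1ℚ} _ ⟩
    1ℚ + 1ℚ                ≤⟨ +-mono-≤ 1≤δn 1≤δn ⟩
    δ * ℕ→ℚ n + δ * ℕ→ℚ n  ≡⟨ *-distribˡ-+ δ (ℕ→ℚ n) (ℕ→ℚ n) ⟨
    δ * (ℕ→ℚ n + ℕ→ℚ n)    ≡⟨ cong (δ *_) (ℕ→ℚ-+ n n) ⟨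
    δ * ℕ→ℚ (n ℕ.+ n)      ≤⟨ δ*a≤b L 1 0≤δ δ2L≤1
                                (ℕ.≤-trans (ℕ.+-mono-≤ n≤L n≤L) (ℕ.≤-reflexive (L+L≡1*[2*L] L))) ⟩
    1ℚ                     ∎
... | suc q | n<[2+q]L = δ*a≤b L (suc q) 0≤δ δ2L≤1
  (ℕ.≤-trans (ℕ.<⇒≤ n<[2+q]L) (ℕ.≤-trans (ℕ.m≤m+n _ (q ℕ.* L)) (ℕ.≤-reflexive (regroup q L))))
  where
  regroup : ∀ q L → suc (suc q) ℕ.* L ℕ.+ q ℕ.* L ≡ suc q ℕ.* (2 ℕ.* L)
  regroup = solve-∀

sparse-blockade : ∀ {ε k n} (G : Graph n) → 0ℚ ≤ ε → ε ≤ ½ → ℕ→ℚ k * ε ≤ ℕ→ℚ 2 →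
  Sparse (ε ^ℚ 18) G → P5Free G → 1ℚ ≤ ℕ→ℚ n * (ε ^ℚ 18) →
  Σ (Fin k → Subset n) λ B → IsAnticompleteBlockade G B × (∀ i → (ε ^ℚ 18) * ℕ→ℚ n ≤ ℕ→ℚ ∣ B i ∣)
sparse-blockade {ε} {k} {n} G 0≤ε ε≤½ kε≤2 sparse P5-free n-large =
  block , anticomplete , λ i → ≤-trans δn≤m (ℕ→ℚ-mono-≤ (large i))
  where
  L = suc (2 ℕ.* k) ℕ.^ 5
  instance
    L≢0 : ℕ.NonZero L
    L≢0 = ℕ.m^n≢0 (suc (2 ℕ.* k)) 5
  m = n / L
  δn≤m : ε ^ℚ 18 * ℕ→ℚ n ≤ ℕ→ℚ m
  δn≤m = δn≤n/L n L (^ℚ-nonNeg 18 0≤ε) (ε¹⁸·2c⁵≤1 (suc (2 ℕ.* k)) 0≤ε ε≤½ ([1+2k]ε≤5 k ε≤½ kε≤2)) n-large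
  degree≤m : ∀ v → degree G v ℕ.≤ m
  degree≤m v = ℕ→ℚ-cancel-≤ (≤-trans (sparse v) δn≤m)
  open Blockade (P5-free⇒blockade G {k} P5-free degree≤m
                  (ℕ.≤-trans (ℕ.≤-reflexive (ℕ.*-comm L m)) (m/n*n≤m n L)))

lemma3p3 : Σ ℕ λ a → a ≥ 2 × (∀ (ε : ℚ) → 0ℚ < ε → ε ≤ ½ →
    ∀ {n} (G : Graph n) → Sparse (ε ^ℚ a) G → P5Free G →
    1ℚ ≤ ℕ→ℚ n * (ε ^ℚ a) →
    Σ ℕ λ k → Σ (Fin k → Subset n) λ B → IsAnticompleteBlockade G B ×
      1ℚ ≤ ℕ→ℚ k * ε × (∀ i → (ε ^ℚ a) * ℕ→ℚ n ≤ ℕ→ℚ ∣ B i ∣))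
lemma3p3 = 18 , ℕ.s≤s (ℕ.s≤s ℕ.z≤n) , λ ε 0<ε ε≤½ G sparse P5-free n-large →
  let k , 1≤kε , kε≤2 = multiple-in-[1,2] ε 0<ε (≤-trans ε≤½ (toWitness {a? = ½ ≤? 1ℚ} _))
      B , B-anti , B-large = sparse-blockade G (<⇒≤ 0<ε) ε≤½ kε≤2 sparse P5-free n-large
  in k , B , B-anti , 1≤kε , B-large
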